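{- For all $n\ge 0$, $$S_F(i_{00}(n))=2S_F(i_0(n))-S_F(i_\varepsilon(n)),\qquad S_F(i_{01}(n))=2S_F(i_\varepsilon(n)),\qquad S_F(i_{010}(n))=3S_F(i_\varepsilon(n)).$$ In particular, $(S_F(n))_{n\ge 0}$ is $F$-regular.
   Context: Let $(F(n))_{n\ge 0}$ be defined by $F(0)=1$, $F(1)=2$, $F(n+2)=F(n+1)+F(n)$. For $n\ge 1$, $\mathrm{rep}_F(n)$ is the greedy (Zeckendorf) representation of $n$: the word $c_{\ell-1}\cdots c_0$ over $\{0,1\}$ with $c_{\ell-1}=1$, no factor $11$, and $n=\sum_j c_jF(j)$; $\mathrm{rep}_F(0)=\varepsilon$. For a word $d_{\ell-1}\cdots d_0$ over $\{0,1\}$, $\mathrm{val}_F(d_{\ell-1}\cdots d_0)=\sum_j d_jF(j)$. Let $L_F=\{\varepsilon\}\cup 1\{0,01\}^*$. For words $u,v$, $\binom{u}{v}$ is the number of occurrences of $v$ as a scattered subword (subsequence) of $u$, and $S_F(n)=\#\{v\in L_F : \binom{\mathrm{rep}_F(n)}{v}>0\}$. For $q\in\{0,1\}^*$, let $i_q(\mathbb{N})=\mathrm{val}_F(0^*\mathrm{rep}_F(\mathbb{N})\cap\{0,1\}^*q)$, the set of integers whose Zeckendorf representation, possibly padded with leading zeroes, ends with $q$; when it is non-empty, write its elements increasingly as $x_{q,0}<x_{q,1}<\cdots$ and set $i_q(n)=x_{q,n}$ (so $i_\varepsilon(n)=n$). The $F$-kernel of a sequence $s=(s(n))_{n\ge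 0}$ is the set of sequences $(s(i_q(n)))_{n}$ over all $q\in\{0,1\}^*$ with $i_q(\mathbb{N})\neq\emptyset$; $s$ is $F$-regular if the $\mathbb{Z}$-module generated by its $F$-kernel is finitely generated. -}

module Defs where

open import Data.Bool using (Bool; true; false; if_then_else_; _∧_)
open import Data.Nat using (ℕ; zero; suc; _+_; _*_; _∸_; _≤ᵇ_; _<ᵇ_)
open import Data.Integer as ℤ using (ℤ; +_)
open import Data.List using (List; []; _∷_; _++_; length; replicate; reverse; dropWhile; filter; map; concat; upTo; foldr)
open import Data.List.Membership.Propositional using (_∈_)
open import Data.Product using (Σ; _×_)
open import Relation.Binary.PropositionalEquality using (_≡_)
open import Relation.Nullary using (does)
open import Data.Bool.Properties using (T?)
open import Data.Bool using (T; not)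

-- Words over {0,1}: false = 0, true = 1.  A word c_{ℓ-1} ⋯ c_0 is the list
-- c_{ℓ-1} ∷ ⋯ ∷ c_0 ∷ [] (most significant digit first).
Word : Set
Word = List Bool

F : ℕ → ℕ
F zero = 1
F (suc zero) = 2
F (suc (suc n)) = F (suc n) + F n

valF : Word → ℕ
valF [] = 0
valF (d ∷ w) = (if d then F (length w) else 0) + valF w

greedy : ℕ → ℕ → Word
greedy zero m = []
greedy (suc j) m = if F j ≤ᵇ m then true ∷ greedy j (m ∸ F j) else false ∷ greedy j m

-- rep_F(n): greedy (Zeckendorf) representation, leading zeros removed
-- (positions 0 … n-1 suffice since F(n) > n).  rep_F(0) = ε.
repF : ℕ → Word
repF n = dropWhile (λ b → T? (not b)) (greedy n n)

_==_ : Bool → Bool → Bool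
true == true = true
false == false = true
_ == _ = false

binom : Word → Word → ℕ
binom u [] = 1
binom [] (_ ∷ _) = 0
binom (a ∷ u) (b ∷ v) = (if a == b then binom u v else 0) + binom u (b ∷ v)

inStar : Word → Bool
inStar [] = true
inStar (false ∷ true ∷ w) = inStar w
inStar (false ∷ w) = inStar w
inStar (true ∷ w) = false

inLF : Word → Bool
inLF [] = true
inLF (true ∷ w) = inStar w
inLF (false ∷ w) = false

wordsOfLen : ℕ → List Word
wordsOfLen zero = [] ∷ []
wordsOfLen (suc k) = map (false ∷_) (wordsOfLen k) ++ map (true ∷_) (wordsOfLen k)

wordsUpTo : ℕ → List Word
wordsUpTo k = concat (map wordsOfLen (upTo (suc k)))

-- S_F(n) = #{ v ∈ L_F : binom(rep_F(n), v) > 0 }.  Any subword of rep_F(n)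
-- has length ≤ |rep_F(n)|, so it suffices to enumerate words up to that length.
SF : ℕ → ℕ
SF n = length (filter (λ v → T? (inLF v ∧ (0 <ᵇ binom (repF n) v))) (wordsUpTo (length (repF n))))

isPrefix : Word → Word → Bool
isPrefix [] w = true
isPrefix (_ ∷ _) [] = false
isPrefix (a ∷ p) (b ∷ w) = (a == b) ∧ isPrefix p w

endsWith : Word → Word → Bool
endsWith q w = isPrefix (reverse q) (reverse w)

-- m ∈ i_q(ℕ) : some zero-padding 0^k rep_F(m) ends with q
-- (padding with |q| zeros is enough, and more zeros change nothing).
inI : Word → ℕ → Bool
inI q m = endsWith q (replicate (length q) false ++ repF m)

countBelow : (ℕ → Bool) → ℕ → ℕ
countBelow p zero = 0
countBelow p (suc m) = countBelow p m + (if p m then 1 else 0)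

-- m is the n-th element (0-indexed, increasing order) of {k : p k}
IsNth : (ℕ → Bool) → ℕ → ℕ → Set
IsNth p n m = (p m ≡ true) × (countBelow p m ≡ n)

Iq : Word → ℕ → ℕ → Set
Iq q n m = IsNth (inI q) n m

-- Kernel: t is in the F-kernel of s if t = (s(i_q(n)))_n for some q with
-- i_q(ℕ) ≠ ∅ (then i_q(ℕ) is infinite, so i_q(n) is defined for every n).
InKernel : (ℕ → ℤ) → (ℕ → ℤ) → Set
InKernel s t = Σ Word λ q → Σ ℕ (λ m → inI q m ≡ true) × (∀ n m → Iq q n m → t n ≡ s m)

data Span (K : (ℕ → ℤ) → Set) : (ℕ → ℤ) → Set where
  gen   : ∀ {t} → K t → Span K t
  zero0 : Span K (λ _ → + 0)
  add   : ∀ {f g} → Span K f → Span K g → Span K (λ n → f n ℤ.+ g n)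
  scale : ∀ {f} (c : ℤ) → Span K f → Span K (λ n → c ℤ.* f n)
  ext   : ∀ {f g} → Span K f → (∀ n → f n ≡ g n) → Span K g

-- s is F-regular: the ℤ-module generated by its F-kernel is finitely
-- generated, i.e. it is spanned by finitely many of its elements.
FRegular : (ℕ → ℤ) → Set
FRegular s = Σ (List (ℕ → ℤ)) λ gs →
  (∀ {g} → g ∈ gs → Span (InKernel s) g) ×
  (∀ {t} → Span (InKernel s) t → Span (λ g → g ∈ gs) t)

-- Write S(u) for the number of v ∈ L_F that are scattered subwords of the word u, and z(u), o(u)
-- for those ending in 0 and in 1, so that S(u) = 1 + z(u) + o(u). Sorting the subwords of ua by
-- whether their last letter is matched by the final a gives z(u0) = z(u) + o(u), o(u0) = o(u),
-- z(u1) = z(u) and o(u1) = 1 + z(u), from which S(u00) + S(u) = 2 S(u0), S(u01) = 2 S(u) and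
-- S(u010) = 3 S(u) for every word u. Leading zeros do not change S, and when q has no factor 11
-- and does not begin with 1, i_q(n) is the value of rep_F(n) q; a suffix 1q′ behaves as 01q′.
-- So every sequence of the F-kernel is n ↦ S(rep_F(n) q) for such a q, and removing a final
-- 00, 01 or 010 from q writes it as a ℤ-combination of S_F and S_F ∘ i_0.

module Submission where

open import Defs
open import Data.Bool using (Bool; true; false; if_then_else_; _∧_; _∨_; not; T)
open import Data.Bool.Properties using (T?; ⇔→≡; ∧-zeroʳ; ∧-identityʳ; ∨-identityʳ; ∨-zeroʳ)
import Data.Nat as ℕ
open import Data.Nat using (ℕ; zero; suc; _+_; _∸_; _≤_; _<_; _≤ᵇ_; _<ᵇ_; z≤n; s≤s)
open import Data.Nat.Properties
open import Data.Nat.ListAction using (sum)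
open import Data.Nat.ListAction.Properties using (sum-++)
open import Data.Nat.Tactic.RingSolver using (solve-∀)
open import Data.List using (List; []; _∷_; _++_; _∷ʳ_; length; null; replicate; reverse; dropWhile; filter; map; concat; upTo; applyUpTo; initLast; _∷ʳ′_)
open import Data.List.Properties using (map-++; map-∘; map-upTo; ++-assoc; length-++; length-++-≤ˡ; length-++-≤ʳ; length-replicate; length-reverse; reverse-++; reverse-involutive; ++-identityʳ)
open import Data.Product using (Σ; _×_; _,_)
open import Data.Sum using (inj₁; inj₂)
open import Relation.Nullary using (contradiction)
open import Relation.Binary using (tri<; tri≈; tri>)
open import Relation.Binary.PropositionalEquality
open import Data.Integer using (ℤ; +_; _*_; _-_; _⊖_; -1ℤ)
import Data.Integer as ℤ
import Data.Integer.Properties as ℤP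
open import Function.Bundles using (mk⇔)
open import Data.List.Reverse using (Reverse; []; _∶_∶ʳ_; reverseView)
open import Data.List.Membership.Propositional using (_∈_)
open import Data.List.Relation.Unary.Any using (here; there)
open ≡-Reasoning

⟦_⟧ : Bool → ℕ
⟦ b ⟧ = if b then 1 else 0

==-refl : ∀ c → (c == c) ≡ true
==-refl true  = refl
==-refl false = refl

-- Sums over words of bounded length

ΣWords : ℕ → (Word → ℕ) → ℕ
ΣWords zero    f = f []
ΣWords (suc k) f = f [] + ΣWords k (λ v → f (false ∷ v)) + ΣWords k (λ v → f (true ∷ v))

ΣWords-cong : ∀ k {f g : Word → ℕ} → (∀ v → f v ≡ g v) → ΣWords k f ≡ ΣWords k g
ΣWords-cong zero    f≗g = f≗g []
ΣWords-cong (suc k) f≗g =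
  cong₂ _+_ (cong₂ _+_ (f≗g []) (ΣWords-cong k (λ v → f≗g (false ∷ v)))) (ΣWords-cong k (λ v → f≗g (true ∷ v)))

ΣWords-+ : ∀ k (f g : Word → ℕ) → ΣWords k (λ v → f v + g v) ≡ ΣWords k f + ΣWords k g
ΣWords-+ zero    f g = refl
ΣWords-+ (suc k) f g
  rewrite ΣWords-+ k (λ v → f (false ∷ v)) (λ v → g (false ∷ v))
        | ΣWords-+ k (λ v → f (true ∷ v)) (λ v → g (true ∷ v)) =
  interchange (f []) (g []) _ _ _ _
  where
  interchange : ∀ a b c d e h → a + b + (c + d) + (e + h) ≡ a + c + e + (b + d + h)
  interchange = solve-∀

ΣWords-0 : ∀ k {f : Word → ℕ} → (∀ v → f v ≡ 0) → ΣWords k f ≡ 0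
ΣWords-0 zero    f≗0 = f≗0 []
ΣWords-0 (suc k) f≗0
  rewrite f≗0 [] | ΣWords-0 k (λ v → f≗0 (false ∷ v)) | ΣWords-0 k (λ v → f≗0 (true ∷ v)) = refl

ΣWords-null : ∀ k → ΣWords k (λ v → ⟦ null v ⟧) ≡ 1
ΣWords-null zero    = refl
ΣWords-null (suc k) rewrite ΣWords-0 k {λ _ → 0} (λ _ → refl) = refl

ΣWords-∷ʳ : ∀ k (f : Word → ℕ) →
  ΣWords (suc k) f ≡ f [] + ΣWords k (λ v → f (v ∷ʳ false)) + ΣWords k (λ v → f (v ∷ʳ true))
ΣWords-∷ʳ zero    f = refl
ΣWords-∷ʳ (suc k) f
  rewrite ΣWords-∷ʳ k (λ v → f (false ∷ v)) | ΣWords-∷ʳ k (λ v → f (true ∷ v)) =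
  regroup (f []) (f (false ∷ [])) (f (true ∷ [])) _ _ _ _
  where
  regroup : ∀ a b c d e g h → a + (b + d + e) + (c + g + h) ≡ a + (b + d + g) + (c + e + h)
  regroup = solve-∀

ΣWords-suc : ∀ k (f : Word → ℕ) → (∀ v → k < length v → f v ≡ 0) → ΣWords (suc k) f ≡ ΣWords k f
ΣWords-suc zero    f long⇒0 rewrite long⇒0 (false ∷ []) (s≤s z≤n) | long⇒0 (true ∷ []) (s≤s z≤n) =
  trans (+-identityʳ _) (+-identityʳ _)
ΣWords-suc (suc k) f long⇒0
  rewrite ΣWords-suc k (λ v → f (false ∷ v)) (λ v k<v → long⇒0 (false ∷ v) (s≤s k<v))
        | ΣWords-suc k (λ v → f (true ∷ v)) (λ v k<v → long⇒0 (true ∷ v) (s≤s k<v)) = refl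

length-filter≡sum : ∀ {A : Set} (p : A → Bool) xs → length (filter (λ x → T? (p x)) xs) ≡ sum (map (λ x → ⟦ p x ⟧) xs)
length-filter≡sum p []       = refl
length-filter≡sum p (x ∷ xs) with p x
... | true  = cong suc (length-filter≡sum p xs)
... | false = length-filter≡sum p xs

sum-map-++ : ∀ {A : Set} (f : A → ℕ) xs ys → sum (map f (xs ++ ys)) ≡ sum (map f xs) + sum (map f ys)
sum-map-++ f xs ys = trans (cong sum (map-++ f xs ys)) (sum-++ (map f xs) (map f ys))

sum-map-concat : ∀ {A : Set} (f : A → ℕ) xss → sum (map f (concat xss)) ≡ sum (map (λ xs → sum (map f xs)) xss)
sum-map-concat f []         = refl
sum-map-concat f (xs ∷ xss) = trans (sum-map-++ f xs (concat xss)) (cong (_+_ (sum (map f xs))) (sum-map-concat f xss))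

ΣLength : ℕ → (Word → ℕ) → ℕ
ΣLength j f = sum (map f (wordsOfLen j))

ΣLength-suc : ∀ j f → ΣLength (suc j) f ≡ ΣLength j (λ v → f (false ∷ v)) + ΣLength j (λ v → f (true ∷ v))
ΣLength-suc j f = trans (sum-map-++ f (map (false ∷_) (wordsOfLen j)) (map (true ∷_) (wordsOfLen j)))
  (cong₂ (λ xs ys → sum xs + sum ys) (sym (map-∘ (wordsOfLen j))) (sym (map-∘ (wordsOfLen j))))

sum-applyUpTo-cong : ∀ {a b : ℕ → ℕ} n → (∀ j → a j ≡ b j) → sum (applyUpTo a n) ≡ sum (applyUpTo b n)
sum-applyUpTo-cong zero    a≗b = refl
sum-applyUpTo-cong (suc n) a≗b = cong₂ _+_ (a≗b 0) (sum-applyUpTo-cong n (λ j → a≗b (suc j)))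

sum-applyUpTo-+ : ∀ (a b : ℕ → ℕ) n → sum (applyUpTo (λ j → a j + b j) n) ≡ sum (applyUpTo a n) + sum (applyUpTo b n)
sum-applyUpTo-+ a b zero    = refl
sum-applyUpTo-+ a b (suc n) rewrite sum-applyUpTo-+ (λ j → a (suc j)) (λ j → b (suc j)) n =
  +-+-interchange (a 0) (b 0) _ _
  where
  +-+-interchange : ∀ x y z w → x + y + (z + w) ≡ x + z + (y + w)
  +-+-interchange = solve-∀

ΣΣLength≡ΣWords : ∀ k f → sum (applyUpTo (λ j → ΣLength j f) (suc k)) ≡ ΣWords k f
ΣΣLength≡ΣWords zero    f = trans (+-identityʳ _) (+-identityʳ _)
ΣΣLength≡ΣWords (suc k) f = begin
  ΣLength 0 f + sum (applyUpTo (λ j → ΣLength (suc j) f) (suc k))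
    ≡⟨ cong₂ _+_ (+-identityʳ (f [])) (sum-applyUpTo-cong (suc k) (λ j → ΣLength-suc j f)) ⟩
  f [] + sum (applyUpTo (λ j → ΣLength j f₀ + ΣLength j f₁) (suc k))
    ≡⟨ cong (_+_ (f [])) (sum-applyUpTo-+ (λ j → ΣLength j f₀) (λ j → ΣLength j f₁) (suc k)) ⟩
  f [] + (sum (applyUpTo (λ j → ΣLength j f₀) (suc k)) + sum (applyUpTo (λ j → ΣLength j f₁) (suc k)))
    ≡⟨ cong (_+_ (f [])) (cong₂ _+_ (ΣΣLength≡ΣWords k f₀) (ΣΣLength≡ΣWords k f₁)) ⟩
  f [] + (ΣWords k f₀ + ΣWords k f₁)
    ≡⟨ +-assoc (f []) _ _ ⟨
  ΣWords (suc k) f ∎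
  where
  f₀ f₁ : Word → ℕ
  f₀ v = f (false ∷ v)
  f₁ v = f (true ∷ v)

count-wordsUpTo : ∀ k (p : Word → Bool) → length (filter (λ v → T? (p v)) (wordsUpTo k)) ≡ ΣWords k (λ v → ⟦ p v ⟧)
count-wordsUpTo k p = begin
  length (filter (λ v → T? (p v)) (wordsUpTo k))
    ≡⟨ length-filter≡sum p (wordsUpTo k) ⟩
  sum (map χ (concat (map wordsOfLen (upTo (suc k)))))
    ≡⟨ sum-map-concat χ (map wordsOfLen (upTo (suc k))) ⟩
  sum (map (λ xs → sum (map χ xs)) (map wordsOfLen (upTo (suc k))))
    ≡⟨ cong sum (sym (map-∘ {g = λ xs → sum (map χ xs)} {f = wordsOfLen} (upTo (suc k)))) ⟩
  sum (map (λ j → ΣLength j χ) (upTo (suc k)))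
    ≡⟨ cong sum (map-upTo (λ j → ΣLength j χ) (suc k)) ⟩
  sum (applyUpTo (λ j → ΣLength j χ) (suc k))
    ≡⟨ ΣΣLength≡ΣWords k χ ⟩
  ΣWords k χ ∎
  where
  χ : Word → ℕ
  χ v = ⟦ p v ⟧

-- Scattered subwords and the language L_F

hasSubword : Word → Word → Bool
hasSubword u       []      = true
hasSubword []      (_ ∷ _) = false
hasSubword (a ∷ u) (b ∷ v) = ((a == b) ∧ hasSubword u v) ∨ hasSubword u (b ∷ v)

0<ᵇ-+ : ∀ x y → (0 <ᵇ (x + y)) ≡ (0 <ᵇ x) ∨ (0 <ᵇ y)
0<ᵇ-+ zero    y = refl
0<ᵇ-+ (suc x) y = refl

0<ᵇbinom≡hasSubword : ∀ u v → (0 <ᵇ binom u v) ≡ hasSubword u v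
0<ᵇbinom≡hasSubword u       []      = refl
0<ᵇbinom≡hasSubword []      (b ∷ v) = refl
0<ᵇbinom≡hasSubword (a ∷ u) (b ∷ v)
  rewrite 0<ᵇ-+ (if a == b then binom u v else 0) (binom u (b ∷ v)) | 0<ᵇbinom≡hasSubword u (b ∷ v) with a == b
... | true  rewrite 0<ᵇbinom≡hasSubword u v = refl
... | false = refl

∨-leftComm : ∀ x y z → x ∨ (y ∨ z) ≡ y ∨ (x ∨ z)
∨-leftComm true  y z = sym (∨-zeroʳ y)
∨-leftComm false y z = refl

hasSubword-[]-∷ʳ : ∀ v d → hasSubword [] (v ∷ʳ d) ≡ false
hasSubword-[]-∷ʳ []      d = refl
hasSubword-[]-∷ʳ (_ ∷ _) d = refl

hasSubword-∷ʳ-∷ʳ : ∀ u v c d → hasSubword (u ∷ʳ c) (v ∷ʳ d) ≡ ((c == d) ∧ hasSubword u v) ∨ hasSubword u (v ∷ʳ d)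
hasSubword-∷ʳ-∷ʳ []      []      c d = refl
hasSubword-∷ʳ-∷ʳ []      (b ∷ v) c d rewrite hasSubword-[]-∷ʳ v d | ∧-zeroʳ (c == b) | ∧-zeroʳ (c == d) = refl
hasSubword-∷ʳ-∷ʳ (a ∷ u) []      c d rewrite hasSubword-∷ʳ-∷ʳ u [] c d =
  ∨-leftComm ((a == d) ∧ true) ((c == d) ∧ true) _
hasSubword-∷ʳ-∷ʳ (a ∷ u) (b ∷ v) c d rewrite hasSubword-∷ʳ-∷ʳ u v c d | hasSubword-∷ʳ-∷ʳ u (b ∷ v) c d =
  rearrange (a == b) (c == d) _ _ _ _
  where
  rearrange : ∀ e f p q r s → (e ∧ ((f ∧ p) ∨ r)) ∨ ((f ∧ q) ∨ s) ≡ (f ∧ ((e ∧ p) ∨ q)) ∨ ((e ∧ r) ∨ s)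
  rearrange false true  p     q r s = refl
  rearrange false false p     q r s = refl
  rearrange true  false p     q r s = refl
  rearrange true  true  true  q r s = refl
  rearrange true  true  false q r s = ∨-leftComm r q s

hasSubword-∷ʳ⁻ : ∀ u v c → hasSubword u (v ∷ʳ c) ≡ true → hasSubword u v ≡ true
hasSubword-∷ʳ⁻ []      v       c h rewrite hasSubword-[]-∷ʳ v c with h
... | ()
hasSubword-∷ʳ⁻ (a ∷ u) []      c h = refl
hasSubword-∷ʳ⁻ (a ∷ u) (b ∷ v) c h with a == b | hasSubword u (v ∷ʳ c) in p | hasSubword u (b ∷ v ∷ʳ c) in q
... | true  | true  | _    rewrite hasSubword-∷ʳ⁻ u v c p = refl
... | _     | _     | true rewrite hasSubword-∷ʳ⁻ u (b ∷ v) c q = ∨-zeroʳ _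
hasSubword-∷ʳ⁻ (a ∷ u) (b ∷ v) c () | true  | false | false
hasSubword-∷ʳ⁻ (a ∷ u) (b ∷ v) c () | false | _     | false

hasSubword-∷ʳ-cancel : ∀ u v c → hasSubword (u ∷ʳ c) (v ∷ʳ c) ≡ hasSubword u v
hasSubword-∷ʳ-cancel u v c rewrite hasSubword-∷ʳ-∷ʳ u v c c | ==-refl c with hasSubword u (v ∷ʳ c) in eq
... | true  rewrite hasSubword-∷ʳ⁻ u v c eq = refl
... | false = ∨-identityʳ _

length<⇒¬hasSubword : ∀ u v → length u < length v → hasSubword u v ≡ false
length<⇒¬hasSubword []      (b ∷ v) _ = refl
length<⇒¬hasSubword (a ∷ u) (b ∷ v) (s≤s u<v)
  rewrite length<⇒¬hasSubword u v u<v | length<⇒¬hasSubword u (b ∷ v) (m<n⇒m<1+n u<v) | ∧-zeroʳ (a == b) = refl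

lastIs : Bool → Word → Bool
lastIs c []          = false
lastIs c (a ∷ [])    = a == c
lastIs c (_ ∷ b ∷ w) = lastIs c (b ∷ w)

lastIs-∷ʳ : ∀ c v d → lastIs c (v ∷ʳ d) ≡ (d == c)
lastIs-∷ʳ c []          d = refl
lastIs-∷ʳ c (a ∷ [])    d = refl
lastIs-∷ʳ c (a ∷ b ∷ v) d = lastIs-∷ʳ c (b ∷ v) d

lastIs-true : ∀ a w → lastIs true (a ∷ w) ≡ not (lastIs false (a ∷ w))
lastIs-true true  []      = refl
lastIs-true false []      = refl
lastIs-true a     (b ∷ w) = lastIs-true b w

inStar-∷ʳ0 : ∀ w → inStar (w ∷ʳ false) ≡ inStar w
inStar-∷ʳ0 []                 = refl
inStar-∷ʳ0 (false ∷ [])       = refl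
inStar-∷ʳ0 (false ∷ true ∷ w)  = inStar-∷ʳ0 w
inStar-∷ʳ0 (false ∷ false ∷ w) = inStar-∷ʳ0 (false ∷ w)
inStar-∷ʳ0 (true ∷ w)          = refl

inLF-∷ʳ0 : ∀ v → inLF (v ∷ʳ false) ≡ inLF v ∧ not (null v)
inLF-∷ʳ0 []          = refl
inLF-∷ʳ0 (false ∷ w) = refl
inLF-∷ʳ0 (true ∷ w)  rewrite inStar-∷ʳ0 w = sym (∧-identityʳ _)

inStar-∷ʳ1 : ∀ w → inStar (w ∷ʳ true) ≡ inStar w ∧ lastIs false w
inStar-∷ʳ1 []                     = refl
inStar-∷ʳ1 (false ∷ [])           = refl
inStar-∷ʳ1 (false ∷ true ∷ [])     = refl
inStar-∷ʳ1 (false ∷ true ∷ x ∷ w)  = inStar-∷ʳ1 (x ∷ w)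
inStar-∷ʳ1 (false ∷ false ∷ w)     = inStar-∷ʳ1 (false ∷ w)
inStar-∷ʳ1 (true ∷ w)              = refl

inLF-∷ʳ1 : ∀ v → inLF (v ∷ʳ true) ≡ null v ∨ (inLF v ∧ lastIs false v)
inLF-∷ʳ1 []              = refl
inLF-∷ʳ1 (false ∷ w)     = refl
inLF-∷ʳ1 (true ∷ [])     = refl
inLF-∷ʳ1 (true ∷ x ∷ w)  = inStar-∷ʳ1 (x ∷ w)

-- Counting the subwords that lie in L_F

length-∷ʳ : ∀ (u : Word) c → length (u ∷ʳ c) ≡ suc (length u)
length-∷ʳ []      c = refl
length-∷ʳ (_ ∷ u) c = cong suc (length-∷ʳ u c)

subwordTerm : (Word → Bool) → Word → Word → ℕ
subwordTerm P u v = ⟦ P v ∧ hasSubword u v ⟧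

countSubwords : (Word → Bool) → Word → ℕ
countSubwords P u = ΣWords (length u) (subwordTerm P u)

subwordTerm-long : ∀ P u v → length u < length v → subwordTerm P u v ≡ 0
subwordTerm-long P u v u<v rewrite length<⇒¬hasSubword u v u<v | ∧-zeroʳ (P v) = refl

ΣSnoc : (Word → Bool) → Word → ℕ → Bool → ℕ
ΣSnoc P u k d = ΣWords k (λ v → subwordTerm P u (v ∷ʳ d))

countSubwords-∷ʳ : ∀ P u c →
  countSubwords P (u ∷ʳ c) ≡ subwordTerm P (u ∷ʳ c) [] + ΣSnoc P (u ∷ʳ c) (length u) false + ΣSnoc P (u ∷ʳ c) (length u) true
countSubwords-∷ʳ P u c rewrite length-∷ʳ u c = ΣWords-∷ʳ (length u) (subwordTerm P (u ∷ʳ c))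

countSubwords-byLast : ∀ P u →
  countSubwords P u ≡ subwordTerm P u [] + ΣSnoc P u (length u) false + ΣSnoc P u (length u) true
countSubwords-byLast P u =
  trans (sym (ΣWords-suc (length u) (subwordTerm P u) (subwordTerm-long P u))) (ΣWords-∷ʳ (length u) (subwordTerm P u))

subwordTerm-∷ʳ-other : ∀ P u v c d → (c == d) ≡ false → subwordTerm P (u ∷ʳ c) (v ∷ʳ d) ≡ subwordTerm P u (v ∷ʳ d)
subwordTerm-∷ʳ-other P u v c d c≢d rewrite hasSubword-∷ʳ-∷ʳ u v c d | c≢d = refl

LFEnding : Bool → Word → Bool
LFEnding c v = inLF v ∧ lastIs c v

countLF : Word → ℕ
countLF = countSubwords inLF

countLFEnding : Bool → Word → ℕ
countLFEnding c = countSubwords (LFEnding c)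

LFEnding-∷ʳ-other : ∀ c d → (d == c) ≡ false → ∀ u v → subwordTerm (LFEnding c) u (v ∷ʳ d) ≡ 0
LFEnding-∷ʳ-other c d d≢c u v rewrite lastIs-∷ʳ c v d | d≢c | ∧-zeroʳ (inLF (v ∷ʳ d)) = refl

ΣSnoc-LFEnding-other : ∀ c d → (d == c) ≡ false → ∀ u k → ΣSnoc (LFEnding c) u k d ≡ 0
ΣSnoc-LFEnding-other c d d≢c u k = ΣWords-0 k (LFEnding-∷ʳ-other c d d≢c u)

⟦∧⟧-split : ∀ x b h → ⟦ x ∧ h ⟧ ≡ ⟦ (x ∧ b) ∧ h ⟧ + ⟦ (x ∧ not b) ∧ h ⟧
⟦∧⟧-split false b     h     = refl
⟦∧⟧-split true  true  true  = refl
⟦∧⟧-split true  true  false = refl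
⟦∧⟧-split true  false true  = refl
⟦∧⟧-split true  false false = refl

inLF-byLast : ∀ u v → subwordTerm inLF u v ≡ ⟦ null v ⟧ + subwordTerm (LFEnding false) u v + subwordTerm (LFEnding true) u v
inLF-byLast u []      = refl
inLF-byLast u (a ∷ w) rewrite lastIs-true a w = ⟦∧⟧-split (inLF (a ∷ w)) (lastIs false (a ∷ w)) (hasSubword u (a ∷ w))

countLF-byLast : ∀ u → countLF u ≡ 1 + countLFEnding false u + countLFEnding true u
countLF-byLast u = begin
  countLF u
    ≡⟨ ΣWords-cong k (inLF-byLast u) ⟩
  ΣWords k (λ v → ⟦ null v ⟧ + subwordTerm (LFEnding false) u v + subwordTerm (LFEnding true) u v)
    ≡⟨ ΣWords-+ k _ (subwordTerm (LFEnding true) u) ⟩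
  ΣWords k (λ v → ⟦ null v ⟧ + subwordTerm (LFEnding false) u v) + countLFEnding true u
    ≡⟨ cong (_+ countLFEnding true u) (ΣWords-+ k (λ v → ⟦ null v ⟧) (subwordTerm (LFEnding false) u)) ⟩
  ΣWords k (λ v → ⟦ null v ⟧) + countLFEnding false u + countLFEnding true u
    ≡⟨ cong (λ n → n + countLFEnding false u + countLFEnding true u) (ΣWords-null k) ⟩
  1 + countLFEnding false u + countLFEnding true u ∎
  where
  k : ℕ
  k = length u

countLFEnding0-∷ʳ0 : ∀ u → countLFEnding false (u ∷ʳ false) ≡ countLFEnding false u + countLFEnding true u
countLFEnding0-∷ʳ0 u = begin
  countLFEnding false (u ∷ʳ false)
    ≡⟨ countSubwords-∷ʳ (LFEnding false) u false ⟩
  ΣSnoc (LFEnding false) (u ∷ʳ false) k false + ΣSnoc (LFEnding false) (u ∷ʳ false) k true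
    ≡⟨ cong₂ _+_ (ΣWords-cong k pointwise) (ΣSnoc-LFEnding-other false true refl (u ∷ʳ false) k) ⟩
  ΣWords k (λ v → subwordTerm (LFEnding false) u v + subwordTerm (LFEnding true) u v) + 0
    ≡⟨ +-identityʳ _ ⟩
  ΣWords k (λ v → subwordTerm (LFEnding false) u v + subwordTerm (LFEnding true) u v)
    ≡⟨ ΣWords-+ k (subwordTerm (LFEnding false) u) (subwordTerm (LFEnding true) u) ⟩
  countLFEnding false u + countLFEnding true u ∎
  where
  k : ℕ
  k = length u
  pointwise : ∀ v → subwordTerm (LFEnding false) (u ∷ʳ false) (v ∷ʳ false)
                  ≡ subwordTerm (LFEnding false) u v + subwordTerm (LFEnding true) u v
  pointwise v rewrite hasSubword-∷ʳ-cancel u v false | inLF-∷ʳ0 v | lastIs-∷ʳ false v false with v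
  ... | []    = refl
  ... | a ∷ w rewrite ∧-identityʳ (inLF (a ∷ w)) | ∧-identityʳ (inLF (a ∷ w)) = inLF-byLast u (a ∷ w)

countLFEnding1-∷ʳ0 : ∀ u → countLFEnding true (u ∷ʳ false) ≡ countLFEnding true u
countLFEnding1-∷ʳ0 u = begin
  countLFEnding true (u ∷ʳ false)
    ≡⟨ countSubwords-∷ʳ (LFEnding true) u false ⟩
  ΣSnoc (LFEnding true) (u ∷ʳ false) k false + ΣSnoc (LFEnding true) (u ∷ʳ false) k true
    ≡⟨ cong₂ _+_ (ΣSnoc-LFEnding-other true false refl (u ∷ʳ false) k)
                 (ΣWords-cong k (λ v → subwordTerm-∷ʳ-other (LFEnding true) u v false true refl)) ⟩
  0 + ΣSnoc (LFEnding true) u k true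
    ≡⟨ cong (_+ ΣSnoc (LFEnding true) u k true) (ΣSnoc-LFEnding-other true false refl u k) ⟨
  ΣSnoc (LFEnding true) u k false + ΣSnoc (LFEnding true) u k true
    ≡⟨ countSubwords-byLast (LFEnding true) u ⟨
  countLFEnding true u ∎
  where
  k : ℕ
  k = length u

countLFEnding0-∷ʳ1 : ∀ u → countLFEnding false (u ∷ʳ true) ≡ countLFEnding false u
countLFEnding0-∷ʳ1 u = begin
  countLFEnding false (u ∷ʳ true)
    ≡⟨ countSubwords-∷ʳ (LFEnding false) u true ⟩
  ΣSnoc (LFEnding false) (u ∷ʳ true) k false + ΣSnoc (LFEnding false) (u ∷ʳ true) k true
    ≡⟨ cong₂ _+_ (ΣWords-cong k (λ v → subwordTerm-∷ʳ-other (LFEnding false) u v true false refl))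
                 (ΣSnoc-LFEnding-other false true refl (u ∷ʳ true) k) ⟩
  ΣSnoc (LFEnding false) u k false + 0
    ≡⟨ cong (_+_ (ΣSnoc (LFEnding false) u k false)) (ΣSnoc-LFEnding-other false true refl u k) ⟨
  ΣSnoc (LFEnding false) u k false + ΣSnoc (LFEnding false) u k true
    ≡⟨ countSubwords-byLast (LFEnding false) u ⟨
  countLFEnding false u ∎
  where
  k : ℕ
  k = length u

countLFEnding1-∷ʳ1 : ∀ u → countLFEnding true (u ∷ʳ true) ≡ 1 + countLFEnding false u
countLFEnding1-∷ʳ1 u = begin
  countLFEnding true (u ∷ʳ true)
    ≡⟨ countSubwords-∷ʳ (LFEnding true) u true ⟩
  ΣSnoc (LFEnding true) (u ∷ʳ true) k false + ΣSnoc (LFEnding true) (u ∷ʳ true) k true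
    ≡⟨ cong₂ _+_ (ΣSnoc-LFEnding-other true false refl (u ∷ʳ true) k) (ΣWords-cong k pointwise) ⟩
  ΣWords k (λ v → ⟦ null v ⟧ + subwordTerm (LFEnding false) u v)
    ≡⟨ ΣWords-+ k (λ v → ⟦ null v ⟧) (subwordTerm (LFEnding false) u) ⟩
  ΣWords k (λ v → ⟦ null v ⟧) + countLFEnding false u
    ≡⟨ cong (_+ countLFEnding false u) (ΣWords-null k) ⟩
  1 + countLFEnding false u ∎
  where
  k : ℕ
  k = length u
  pointwise : ∀ v → subwordTerm (LFEnding true) (u ∷ʳ true) (v ∷ʳ true) ≡ ⟦ null v ⟧ + subwordTerm (LFEnding false) u v
  pointwise v rewrite hasSubword-∷ʳ-cancel u v true | inLF-∷ʳ1 v | lastIs-∷ʳ true v true with v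
  ... | []    = refl
  ... | a ∷ w rewrite ∧-identityʳ (inLF (a ∷ w) ∧ lastIs false (a ∷ w)) = refl

countLF-∷ʳ00 : ∀ u → countLF ((u ∷ʳ false) ∷ʳ false) + countLF u ≡ 2 ℕ.* countLF (u ∷ʳ false)
countLF-∷ʳ00 u
  rewrite countLF-byLast ((u ∷ʳ false) ∷ʳ false) | countLF-byLast (u ∷ʳ false) | countLF-byLast u
        | countLFEnding0-∷ʳ0 (u ∷ʳ false) | countLFEnding1-∷ʳ0 (u ∷ʳ false)
        | countLFEnding0-∷ʳ0 u | countLFEnding1-∷ʳ0 u =
  arith (countLFEnding false u) (countLFEnding true u)
  where
  arith : ∀ z o → 1 + (z + o + o) + o + (1 + z + o) ≡ 2 ℕ.* (1 + (z + o) + o)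
  arith = solve-∀

countLF-∷ʳ01 : ∀ u → countLF ((u ∷ʳ false) ∷ʳ true) ≡ 2 ℕ.* countLF u
countLF-∷ʳ01 u
  rewrite countLF-byLast ((u ∷ʳ false) ∷ʳ true) | countLF-byLast u
        | countLFEnding0-∷ʳ1 (u ∷ʳ false) | countLFEnding1-∷ʳ1 (u ∷ʳ false) | countLFEnding0-∷ʳ0 u =
  arith (countLFEnding false u) (countLFEnding true u)
  where
  arith : ∀ z o → 1 + (z + o) + (1 + (z + o)) ≡ 2 ℕ.* (1 + z + o)
  arith = solve-∀

countLF-∷ʳ010 : ∀ u → countLF (((u ∷ʳ false) ∷ʳ true) ∷ʳ false) ≡ 3 ℕ.* countLF u
countLF-∷ʳ010 u
  rewrite countLF-byLast (((u ∷ʳ false) ∷ʳ true) ∷ʳ false) | countLF-byLast u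
        | countLFEnding0-∷ʳ0 ((u ∷ʳ false) ∷ʳ true) | countLFEnding1-∷ʳ0 ((u ∷ʳ false) ∷ʳ true)
        | countLFEnding0-∷ʳ1 (u ∷ʳ false) | countLFEnding1-∷ʳ1 (u ∷ʳ false) | countLFEnding0-∷ʳ0 u =
  arith (countLFEnding false u) (countLFEnding true u)
  where
  arith : ∀ z o → 1 + (z + o + (1 + (z + o))) + (1 + (z + o)) ≡ 3 ℕ.* (1 + z + o)
  arith = solve-∀

countLF-0∷ : ∀ u → countLF (false ∷ u) ≡ countLF u
countLF-0∷ u = trans (ΣWords-cong (suc (length u)) pointwise) (ΣWords-suc (length u) (subwordTerm inLF u) (subwordTerm-long inLF u))
  where
  pointwise : ∀ v → subwordTerm inLF (false ∷ u) v ≡ subwordTerm inLF u v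
  pointwise []          = refl
  pointwise (false ∷ w) = refl
  pointwise (true ∷ w)  = refl

countLF-0*++ : ∀ b u → countLF (replicate b false ++ u) ≡ countLF u
countLF-0*++ zero    u = refl
countLF-0*++ (suc b) u = trans (countLF-0∷ (replicate b false ++ u)) (countLF-0*++ b u)

SF≡countLF-repF : ∀ n → SF n ≡ countLF (repF n)
SF≡countLF-repF n = trans (count-wordsUpTo (length (repF n)) (λ v → inLF v ∧ (0 <ᵇ binom (repF n) v)))
  (ΣWords-cong (length (repF n)) (λ v → cong (λ b → ⟦ inLF v ∧ b ⟧) (0<ᵇbinom≡hasSubword (repF n) v)))

-- Zeckendorf representations

≤ᵇ≡true⇒≤ : ∀ m n → (m ≤ᵇ n) ≡ true → m ≤ n
≤ᵇ≡true⇒≤ m n eq = ≤ᵇ⇒≤ m n (subst T (sym eq) _)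

≤ᵇ≡false⇒> : ∀ m n → (m ≤ᵇ n) ≡ false → n < m
≤ᵇ≡false⇒> m n eq = ≰⇒> λ m≤n → subst T eq (≤⇒≤ᵇ m≤n)

<⇒≤ᵇ≡false : ∀ {m n} → n < m → (m ≤ᵇ n) ≡ false
<⇒≤ᵇ≡false {m} {n} n<m with m ≤ᵇ n in eq
... | false = refl
... | true  = contradiction (≤ᵇ≡true⇒≤ m n eq) (<⇒≱ n<m)

≤⇒≤ᵇ≡true : ∀ {m n} → m ≤ n → (m ≤ᵇ n) ≡ true
≤⇒≤ᵇ≡true {m} {n} m≤n with m ≤ᵇ n | ≤⇒≤ᵇ m≤n
... | true | _ = refl

F-pos : ∀ n → 0 < F n
F-pos zero          = s≤s z≤n
F-pos (suc zero)    = s≤s z≤n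
F-pos (suc (suc n)) = <-≤-trans (F-pos (suc n)) (m≤m+n (F (suc n)) (F n))

F-<-suc : ∀ n → F n < F (suc n)
F-<-suc zero    = s≤s (s≤s z≤n)
F-<-suc (suc n) = m<m+n (F (suc n)) (F-pos n)

F-mono-≤ : ∀ {m n} → m ≤ n → F m ≤ F n
F-mono-≤ {m} {n} m≤n = subst (λ k → F m ≤ F k) (m+[n∸m]≡n m≤n) (F-≤-+ m (n ∸ m))
  where
  F-≤-+ : ∀ m o → F m ≤ F (m + o)
  F-≤-+ m zero    rewrite +-identityʳ m = ≤-refl
  F-≤-+ m (suc o) rewrite +-suc m o = ≤-trans (F-≤-+ m o) (<⇒≤ (F-<-suc (m + o)))

n<F : ∀ n → n < F n
n<F zero    = s≤s z≤n
n<F (suc n) = ≤-<-trans (n<F n) (F-<-suc n)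

F-suc≤2F : ∀ n → F (suc n) ≤ F n + F n
F-suc≤2F zero    = ≤-refl
F-suc≤2F (suc n) = +-monoʳ-≤ (F (suc n)) (<⇒≤ (F-<-suc n))

∸-<ˡ : ∀ {m n k} → n ≤ m → m < n + k → m ∸ n < k
∸-<ˡ {m} {n} {k} n≤m m<n+k = +-cancelˡ-< n (m ∸ n) k (subst (_< n + k) (sym (m+[n∸m]≡n n≤m)) m<n+k)

no11 : Word → Bool
no11 []                 = true
no11 (false ∷ w)        = no11 w
no11 (true ∷ [])        = true
no11 (true ∷ true ∷ w)  = false
no11 (true ∷ false ∷ w) = no11 w

no11-∷⁻ : ∀ a w → no11 (a ∷ w) ≡ true → no11 w ≡ true
no11-∷⁻ false w           h = h
no11-∷⁻ true  []          h = refl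
no11-∷⁻ true  (false ∷ w) h = h

valShift : ℕ → Word → ℕ
valShift r []      = 0
valShift r (d ∷ w) = (if d then F (length w + r) else 0) + valShift r w

valF-++ : ∀ x q → valF (x ++ q) ≡ valShift (length q) x + valF q
valF-++ []      q = refl
valF-++ (d ∷ x) q rewrite length-++ x {q} | valF-++ x q = sym (+-assoc _ (valShift (length q) x) (valF q))

valShift-0*++ : ∀ r d x → valShift r (replicate d false ++ x) ≡ valShift r x
valShift-0*++ r zero    x = refl
valShift-0*++ r (suc d) x = valShift-0*++ r d x

valShift<F : ∀ r x → no11 x ≡ true → valShift r x < F (length x + r)
valShift<F r []                 _ = F-pos r
valShift<F r (false ∷ w)        h = <-≤-trans (valShift<F r w h) (<⇒≤ (F-<-suc (length w + r)))
valShift<F r (true ∷ [])        _ = subst (_< F (suc r)) (sym (+-identityʳ (F r))) (F-<-suc r)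
valShift<F r (true ∷ false ∷ w) h = +-monoʳ-< (F (suc (length w + r))) (valShift<F r w h)

valF<F : ∀ w → no11 w ≡ true → valF w < F (length w)
valF<F w h = subst₂ _<_ (sym (valF≡valShift0 w)) (cong F (+-identityʳ (length w))) (valShift<F 0 w h)
  where
  valF≡valShift0 : ∀ w → valF w ≡ valShift 0 w
  valF≡valShift0 []      = refl
  valF≡valShift0 (d ∷ w) rewrite +-identityʳ (length w) = cong (_+_ (if d then F (length w) else 0)) (valF≡valShift0 w)

length-greedy : ∀ j m → length (greedy j m) ≡ j
length-greedy zero    m = refl
length-greedy (suc j) m with F j ≤ᵇ m
... | true  = cong suc (length-greedy j (m ∸ F j))
... | false = cong suc (length-greedy j m)

greedy-suc : ∀ j m → m < F j → greedy (suc j) m ≡ false ∷ greedy j m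
greedy-suc j m m<Fj rewrite <⇒≤ᵇ≡false m<Fj = refl

greedy-+ : ∀ d j m → m < F j → greedy (d + j) m ≡ replicate d false ++ greedy j m
greedy-+ zero    j m m<Fj = refl
greedy-+ (suc d) j m m<Fj =
  trans (greedy-suc (d + j) m (<-≤-trans m<Fj (F-mono-≤ (m≤n+m j d)))) (cong (false ∷_) (greedy-+ d j m m<Fj))

valF-greedy : ∀ j m → m < F j → valF (greedy j m) ≡ m
valF-greedy zero    zero    _            = refl
valF-greedy zero    (suc m) (s≤s ())
valF-greedy (suc j) m       m<F[1+j] with F j ≤ᵇ m in eq
... | true  rewrite length-greedy j (m ∸ F j)
                  | valF-greedy j (m ∸ F j) (∸-<ˡ (≤ᵇ≡true⇒≤ (F j) m eq) (<-≤-trans m<F[1+j] (F-suc≤2F j))) =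
  m+[n∸m]≡n (≤ᵇ≡true⇒≤ (F j) m eq)
... | false = valF-greedy j m (≤ᵇ≡false⇒> (F j) m eq)

no11-greedy : ∀ j m → m < F j → no11 (greedy j m) ≡ true
no11-greedy zero          m _ = refl
no11-greedy (suc j)       m m<F[1+j] with F j ≤ᵇ m in eq
... | false = no11-greedy j m (≤ᵇ≡false⇒> (F j) m eq)
no11-greedy (suc zero)    m _        | true = refl
no11-greedy (suc (suc j)) m m<F[2+j] | true =
  subst (λ w → no11 (true ∷ w) ≡ true) (sym (greedy-suc j r r<Fj)) (no11-greedy j r r<Fj)
  where
  r : ℕ
  r = m ∸ F (suc j)
  r<Fj : r < F j
  r<Fj = ∸-<ˡ (≤ᵇ≡true⇒≤ (F (suc j)) m eq) m<F[2+j]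

greedy-valF : ∀ w → no11 w ≡ true → greedy (length w) (valF w) ≡ w
greedy-valF []          _ = refl
greedy-valF (false ∷ w) h = trans (greedy-suc (length w) (valF w) (valF<F w h)) (cong (false ∷_) (greedy-valF w h))
greedy-valF (true ∷ w)  h rewrite ≤⇒≤ᵇ≡true (m≤m+n (F (length w)) (valF w)) | m+n∸m≡n (F (length w)) (valF w) =
  cong (true ∷_) (greedy-valF w (no11-∷⁻ true w h))

valShift-greedy-mono : ∀ L r {m m′} → m < m′ → m′ < F L → valShift r (greedy L m) < valShift r (greedy L m′)
valShift-greedy-mono zero    r m<m′ (s≤s z≤n) with () ← m<m′
valShift-greedy-mono (suc L) r {m} {m′} m<m′ m′<F with F L ≤ᵇ m in e | F L ≤ᵇ m′ in e′
... | false | false = valShift-greedy-mono L r m<m′ (≤ᵇ≡false⇒> (F L) m′ e′)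
... | false | true rewrite length-greedy L (m′ ∸ F L) =
  <-≤-trans (subst (λ k → valShift r (greedy L m) < F (k + r)) (length-greedy L m) (valShift<F r (greedy L m) (no11-greedy L m m<FL)))
            (m≤m+n (F (L + r)) _)
  where
  m<FL : m < F L
  m<FL = ≤ᵇ≡false⇒> (F L) m e
... | true | false = contradiction (≤ᵇ≡true⇒≤ (F L) m e) (<⇒≱ (<-trans m<m′ (≤ᵇ≡false⇒> (F L) m′ e′)))
... | true | true rewrite length-greedy L (m ∸ F L) | length-greedy L (m′ ∸ F L) =
  +-monoʳ-< (F (L + r)) (valShift-greedy-mono L r (∸-monoˡ-< m<m′ (≤ᵇ≡true⇒≤ (F L) m e))
                                                  (∸-<ˡ (≤ᵇ≡true⇒≤ (F L) m′ e′) (<-≤-trans m′<F (F-suc≤2F L))))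

==⇒≡ : ∀ a b → (a == b) ≡ true → a ≡ b
==⇒≡ true  true  _ = refl
==⇒≡ false false _ = refl

replicate-+ : ∀ {A : Set} a b (x : A) → replicate (a + b) x ≡ replicate a x ++ replicate b x
replicate-+ zero    b x = refl
replicate-+ (suc a) b x = cong (x ∷_) (replicate-+ a b x)

drop0s : Word → Word
drop0s = dropWhile (λ b → T? (not b))

drop0s-split : ∀ x → Σ ℕ λ b → x ≡ replicate b false ++ drop0s x
drop0s-split []          = 0 , refl
drop0s-split (true ∷ x)  = 0 , refl
drop0s-split (false ∷ x) with b , x≡ ← drop0s-split x = suc b , cong (false ∷_) x≡

greedy-≤ : ∀ {a b m} → a ≤ b → m < F a → greedy b m ≡ replicate (b ∸ a) false ++ greedy a m
greedy-≤ {a} {b} {m} a≤b m<Fa = trans (cong (λ k → greedy k m) (sym (m∸n+n≡m a≤b))) (greedy-+ (b ∸ a) a m m<Fa)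

greedy-padding-invariant : ∀ {A : Set} (h : Word → A) → (∀ d x → h (replicate d false ++ x) ≡ h x) →
  ∀ {a b m} → m < F a → m < F b → h (greedy a m) ≡ h (greedy b m)
greedy-padding-invariant h inv {a} {b} {m} m<Fa m<Fb with ≤-total a b
... | inj₁ a≤b = trans (sym (inv (b ∸ a) (greedy a m))) (cong h (sym (greedy-≤ a≤b m<Fa)))
... | inj₂ b≤a = trans (cong h (greedy-≤ b≤a m<Fb)) (inv (a ∸ b) (greedy b m))

isPrefix-++ : ∀ p y z → length p ≤ length y → isPrefix p (y ++ z) ≡ isPrefix p y
isPrefix-++ []      y       z _         = refl
isPrefix-++ (a ∷ p) (b ∷ y) z (s≤s p≤y) = cong ((a == b) ∧_) (isPrefix-++ p y z p≤y)

isPrefix-++-self : ∀ p z → isPrefix p (p ++ z) ≡ true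
isPrefix-++-self []      z = refl
isPrefix-++-self (a ∷ p) z rewrite ==-refl a = isPrefix-++-self p z

isPrefix⇒++ : ∀ p y → isPrefix p y ≡ true → Σ Word λ z → y ≡ p ++ z
isPrefix⇒++ []      y       _ = y , refl
isPrefix⇒++ (a ∷ p) (b ∷ y) h with a == b in a=b
... | true with z , y≡ ← isPrefix⇒++ p y h = z , cong₂ _∷_ (sym (==⇒≡ a b a=b)) y≡

endsWith-++ˡ : ∀ q z y → length q ≤ length y → endsWith q (z ++ y) ≡ endsWith q y
endsWith-++ˡ q z y q≤y rewrite reverse-++ z y =
  isPrefix-++ (reverse q) (reverse y) (reverse z) (subst₂ _≤_ (sym (length-reverse q)) (sym (length-reverse y)) q≤y)

endsWith-++ : ∀ w q → endsWith q (w ++ q) ≡ true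
endsWith-++ w q rewrite reverse-++ w q = isPrefix-++-self (reverse q) (reverse w)

endsWith-≡++ : ∀ {x} w q → x ≡ w ++ q → endsWith q x ≡ true
endsWith-≡++ w q refl = endsWith-++ w q

endsWith⇒++ : ∀ q x → endsWith q x ≡ true → Σ Word λ w → x ≡ w ++ q
endsWith⇒++ q x h with z , rx≡ ← isPrefix⇒++ (reverse q) (reverse x) h = reverse z , (begin
  x                                 ≡⟨ reverse-involutive x ⟨
  reverse (reverse x)               ≡⟨ cong reverse rx≡ ⟩
  reverse (reverse q ++ z)          ≡⟨ reverse-++ (reverse q) z ⟩
  reverse z ++ reverse (reverse q)  ≡⟨ cong (reverse z ++_) (reverse-involutive q) ⟩
  reverse z ++ q                    ∎)

endsWith-0*++ : ∀ q a D → length q ≤ a → endsWith q (replicate a false ++ D) ≡ endsWith q (replicate (length q) false ++ D)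
endsWith-0*++ q a D q≤a = begin
  endsWith q (replicate a false ++ D)
    ≡⟨ cong (λ k → endsWith q (replicate k false ++ D)) (sym (m∸n+n≡m q≤a)) ⟩
  endsWith q (replicate (a ∸ length q + length q) false ++ D)
    ≡⟨ cong (λ w → endsWith q (w ++ D)) (replicate-+ (a ∸ length q) (length q) false) ⟩
  endsWith q ((replicate (a ∸ length q) false ++ replicate (length q) false) ++ D)
    ≡⟨ cong (endsWith q) (++-assoc (replicate (a ∸ length q) false) _ D) ⟩
  endsWith q (replicate (a ∸ length q) false ++ (replicate (length q) false ++ D))
    ≡⟨ endsWith-++ˡ q (replicate (a ∸ length q) false) _
         (≤-trans (≤-reflexive (sym (length-replicate (length q) {false}))) (length-++-≤ˡ (replicate (length q) false))) ⟩
  endsWith q (replicate (length q) false ++ D) ∎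

-- greedy (K + m) m is rep_F(m) preceded by at least K zeros.
inI≡endsWith-greedy : ∀ q m K → length q ≤ K → inI q m ≡ endsWith q (greedy (K + m) m)
inI≡endsWith-greedy q m K q≤K with b , greedy≡ ← drop0s-split (greedy m m) = sym (begin
  endsWith q (greedy (K + m) m)
    ≡⟨ cong (endsWith q) (greedy-+ K m m (n<F m)) ⟩
  endsWith q (replicate K false ++ greedy m m)
    ≡⟨ cong (λ w → endsWith q (replicate K false ++ w)) greedy≡ ⟩
  endsWith q (replicate K false ++ (replicate b false ++ repF m))
    ≡⟨ cong (endsWith q) (trans (sym (++-assoc (replicate K false) _ _)) (cong (_++ repF m) (sym (replicate-+ K b false)))) ⟩
  endsWith q (replicate (K + b) false ++ repF m)
    ≡⟨ endsWith-0*++ q (K + b) (repF m) (≤-trans q≤K (m≤m+n K b)) ⟩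
  inI q m ∎)

-- The sets i_q(ℕ)

begins1 : Word → Bool
begins1 (true ∷ _) = true
begins1 _          = false

-- The suffixes q for which rep_F(n) q is a Zeckendorf representation for every n.
record Admissible (q : Word) : Set where
  constructor admissible
  field
    no11-q    : no11 q ≡ true
    ¬begins1 : begins1 q ≡ false

no11-++ : ∀ x y → no11 x ≡ true → no11 y ≡ true → begins1 y ≡ false → no11 (x ++ y) ≡ true
no11-++ []                 y _  hy _  = hy
no11-++ (false ∷ x)        y hx hy b1 = no11-++ x y hx hy b1
no11-++ (true ∷ [])        []          _ _  _ = refl
no11-++ (true ∷ [])        (false ∷ y) _ hy _ = hy
no11-++ (true ∷ false ∷ x) y hx hy b1 = no11-++ x y hx hy b1

no11-++⁻ˡ : ∀ x y → no11 (x ++ y) ≡ true → no11 x ≡ true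
no11-++⁻ˡ []                 y _ = refl
no11-++⁻ˡ (false ∷ x)        y h = no11-++⁻ˡ x y h
no11-++⁻ˡ (true ∷ [])        y _ = refl
no11-++⁻ˡ (true ∷ false ∷ x) y h = no11-++⁻ˡ x y h

no11-++⁻ʳ : ∀ x y → no11 (x ++ y) ≡ true → no11 y ≡ true
no11-++⁻ʳ []      y h = h
no11-++⁻ʳ (a ∷ x) y h = no11-++⁻ʳ x y (no11-∷⁻ a (x ++ y) h)

no11-11 : ∀ w q → no11 (w ++ true ∷ true ∷ q) ≡ false
no11-11 []                 q = refl
no11-11 (false ∷ w)        q = no11-11 w q
no11-11 (true ∷ [])        q = refl
no11-11 (true ∷ true ∷ w)  q = refl
no11-11 (true ∷ false ∷ w) q = no11-11 w q

m<F[k+m] : ∀ k m → m < F (k + m)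
m<F[k+m] k m = <-≤-trans (n<F m) (F-mono-≤ (m≤n+m m k))

no11-greedy-+ : ∀ k m → no11 (greedy (k + m) m) ≡ true
no11-greedy-+ k m = no11-greedy (k + m) m (m<F[k+m] k m)

inI⇒greedy≡++ : ∀ q m → inI q m ≡ true → Σ Word λ w → greedy (length q + m) m ≡ w ++ q
inI⇒greedy≡++ q m h = endsWith⇒++ q _ (trans (sym (inI≡endsWith-greedy q m (length q) ≤-refl)) h)

inI⇒no11 : ∀ q m → inI q m ≡ true → no11 q ≡ true
inI⇒no11 q m h with w , greedy≡ ← inI⇒greedy≡++ q m h =
  no11-++⁻ʳ w q (subst (λ x → no11 x ≡ true) greedy≡ (no11-greedy-+ (length q) m))

nthEndingIn : Word → ℕ → ℕ
nthEndingIn q n = valF (greedy n n ++ q)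

no11-greedy-++ : ∀ {q} → Admissible q → ∀ n → no11 (greedy n n ++ q) ≡ true
no11-greedy-++ {q} (admissible no11-q ¬begins1) n = no11-++ (greedy n n) q (no11-greedy n n (n<F n)) no11-q ¬begins1

greedy-nthEndingIn : ∀ {q} → Admissible q → ∀ n → greedy (length (greedy n n ++ q)) (nthEndingIn q n) ≡ greedy n n ++ q
greedy-nthEndingIn adm n = greedy-valF _ (no11-greedy-++ adm n)

inI-nthEndingIn : ∀ {q} → Admissible q → ∀ n → inI q (nthEndingIn q n) ≡ true
inI-nthEndingIn {q} adm n = begin
  inI q a
    ≡⟨ inI≡endsWith-greedy q a L (length-++-≤ʳ q {greedy n n}) ⟩
  endsWith q (greedy (L + a) a)
    ≡⟨ cong (λ k → endsWith q (greedy k a)) (+-comm L a) ⟩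
  endsWith q (greedy (a + L) a)
    ≡⟨ cong (endsWith q) (greedy-+ a L a (valF<F W (no11-greedy-++ adm n))) ⟩
  endsWith q (replicate a false ++ greedy L a)
    ≡⟨ cong (λ w → endsWith q (replicate a false ++ w)) (greedy-nthEndingIn adm n) ⟩
  endsWith q (replicate a false ++ (greedy n n ++ q))
    ≡⟨ endsWith-≡++ (replicate a false ++ greedy n n) q (sym (++-assoc (replicate a false) (greedy n n) q)) ⟩
  true ∎
  where
  W : Word
  W = greedy n n ++ q
  a : ℕ
  a = nthEndingIn q n
  L : ℕ
  L = length W

nthEndingIn-<-suc : ∀ q n → nthEndingIn q n < nthEndingIn q (suc n)
nthEndingIn-<-suc q n rewrite valF-++ (greedy n n) q | valF-++ (greedy (suc n) (suc n)) q =
  +-monoˡ-< (valF q) (subst (λ w → valShift (length q) w < valShift (length q) (greedy (suc n) (suc n)))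
                             (greedy-suc n n (n<F n))
                             (valShift-greedy-mono (suc n) (length q) (n<1+n n) (n<F (suc n))))

inI⇒nthEndingIn : ∀ q m → inI q m ≡ true → Σ ℕ λ j → m ≡ nthEndingIn q j
inI⇒nthEndingIn q m h with w , greedy≡ ← inI⇒greedy≡++ q m h = valF w , (begin
  m                                               ≡⟨ valF-greedy (length q + m) m (m<F[k+m] (length q) m) ⟨
  valF (greedy (length q + m) m)                  ≡⟨ cong valF greedy≡ ⟩
  valF (w ++ q)                                   ≡⟨ valF-++ w q ⟩
  valShift (length q) w + valF q                  ≡⟨ cong (λ x → valShift (length q) x + valF q) (greedy-valF w no11-w) ⟨
  valShift (length q) (greedy (length w) j) + valF q
    ≡⟨ cong (_+ valF q) (greedy-padding-invariant (valShift (length q)) (valShift-0*++ (length q))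
                                                   {length w} {j} (valF<F w no11-w) (n<F j)) ⟩
  valShift (length q) (greedy j j) + valF q       ≡⟨ valF-++ (greedy j j) q ⟨
  nthEndingIn q j                                 ∎)
  where
  j : ℕ
  j = valF w
  no11-w : no11 w ≡ true
  no11-w = no11-++⁻ˡ w q (subst (λ x → no11 x ≡ true) greedy≡ (no11-greedy-+ (length q) m))

countBelow-mono : ∀ p {x y} → x ≤ y → countBelow p x ≤ countBelow p y
countBelow-mono p {x} {y} x≤y = subst (λ k → countBelow p x ≤ countBelow p k) (m+[n∸m]≡n x≤y) (countBelow-≤-+ x (y ∸ x))
  where
  countBelow-≤-+ : ∀ x o → countBelow p x ≤ countBelow p (x + o)
  countBelow-≤-+ x zero    rewrite +-identityʳ x = ≤-refl
  countBelow-≤-+ x (suc o) rewrite +-suc x o = ≤-trans (countBelow-≤-+ x o) (m≤m+n _ _)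

countBelow-< : ∀ p {x y} → p x ≡ true → x < y → countBelow p x < countBelow p y
countBelow-< p {x} px x<y =
  <-≤-trans (subst (λ b → countBelow p x < countBelow p x + ⟦ b ⟧) (sym px) (m<m+n _ (s≤s z≤n))) (countBelow-mono p x<y)

countBelow-gap : ∀ p d x → (∀ k → x ≤ k → k < d + x → p k ≢ true) → countBelow p (d + x) ≡ countBelow p x
countBelow-gap p zero    x _   = refl
countBelow-gap p (suc d) x gap with p (d + x) in pk
... | true  = contradiction pk (gap (d + x) (m≤n+m x d) ≤-refl)
... | false = trans (+-identityʳ _) (countBelow-gap p d x (λ k x≤k k<d+x → gap k x≤k (m≤n⇒m≤1+n k<d+x)))

countBelow-cong : ∀ {p p′} → (∀ k → p k ≡ p′ k) → ∀ m → countBelow p m ≡ countBelow p′ m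
countBelow-cong p≗p′ zero    = refl
countBelow-cong p≗p′ (suc m) = cong₂ (λ c b → c + ⟦ b ⟧) (countBelow-cong p≗p′ m) (p≗p′ m)

IsNth-unique : ∀ p {n m m′} → IsNth p n m → IsNth p n m′ → m ≡ m′
IsNth-unique p {m = m} {m′} (pm , cm) (pm′ , cm′) with <-cmp m m′
... | tri< m<m′ _ _ = contradiction (trans cm (sym cm′)) (<⇒≢ (countBelow-< p pm m<m′))
... | tri≈ _ m≡m′ _ = m≡m′
... | tri> _ _ m′<m = contradiction (trans cm′ (sym cm)) (<⇒≢ (countBelow-< p pm′ m′<m))

IsNth-cong : ∀ {p p′} → (∀ k → p k ≡ p′ k) → ∀ {n m} → IsNth p′ n m → IsNth p n m
IsNth-cong p≗p′ {m = m} (pm , cm) = trans (p≗p′ m) pm , trans (countBelow-cong p≗p′ m) cm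

module _ (p : ℕ → Bool) (e : ℕ → ℕ) (e-<-suc : ∀ n → e n < e (suc n))
         (p-e : ∀ n → p (e n) ≡ true) (p⇒e : ∀ m → p m ≡ true → Σ ℕ λ j → m ≡ e j) where

  private
    e-mono-< : ∀ {i j} → i < j → e i < e j
    e-mono-< {i} {suc j} (s≤s i≤j) with m≤n⇒m<n∨m≡n i≤j
    ... | inj₁ i<j  = <-trans (e-mono-< i<j) (e-<-suc j)
    ... | inj₂ refl = e-<-suc i

    e-mono-≤ : ∀ {i j} → i ≤ j → e i ≤ e j
    e-mono-≤ i≤j with m≤n⇒m<n∨m≡n i≤j
    ... | inj₁ i<j  = <⇒≤ (e-mono-< i<j)
    ... | inj₂ refl = ≤-refl

    e-cancel-< : ∀ {i j} → e i < e j → i < j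
    e-cancel-< ei<ej = ≰⇒> λ j≤i → <⇒≱ ei<ej (e-mono-≤ j≤i)

    countBelow-e : ∀ n → countBelow p (e n) ≡ n
    countBelow-e zero = trans (cong (countBelow p) (sym (+-identityʳ (e 0)))) (countBelow-gap p (e 0) 0 gap)
      where
      gap : ∀ k → 0 ≤ k → k < e 0 + 0 → p k ≢ true
      gap k _ k<e0 pk with j , refl ← p⇒e k pk = <⇒≱ (subst (e j <_) (+-identityʳ (e 0)) k<e0) (e-mono-≤ z≤n)
    countBelow-e (suc n) = begin
      countBelow p (e (suc n))                 ≡⟨ cong (countBelow p) (m∸n+n≡m (e-<-suc n)) ⟨
      countBelow p (d + suc (e n))             ≡⟨ countBelow-gap p d (suc (e n)) gap ⟩
      countBelow p (e n) + ⟦ p (e n) ⟧          ≡⟨ cong₂ (λ c b → c + ⟦ b ⟧) (countBelow-e n) (p-e n) ⟩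
      n + 1                                    ≡⟨ +-comm n 1 ⟩
      suc n                                    ∎
      where
      d : ℕ
      d = e (suc n) ∸ suc (e n)
      gap : ∀ k → suc (e n) ≤ k → k < d + suc (e n) → p k ≢ true
      gap k en<k k<d+ pk with j , refl ← p⇒e k pk =
        <⇒≱ (e-cancel-< (subst (e j <_) (m∸n+n≡m (e-<-suc n)) k<d+)) (e-cancel-< en<k)

  IsNth-enumeration : ∀ n → IsNth p n (e n)
  IsNth-enumeration n = p-e n , countBelow-e n

Iq-nthEndingIn : ∀ {q} → Admissible q → ∀ n → Iq q n (nthEndingIn q n)
Iq-nthEndingIn {q} adm = IsNth-enumeration (inI q) (nthEndingIn q) (nthEndingIn-<-suc q) (inI-nthEndingIn adm) (inI⇒nthEndingIn q)

Iq⇒≡nthEndingIn : ∀ {q} → Admissible q → ∀ {n m} → Iq q n m → m ≡ nthEndingIn q n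
Iq⇒≡nthEndingIn {q} adm {n} iq = IsNth-unique (inI q) iq (Iq-nthEndingIn adm n)

-- S_F along i_q and the F-kernel

SF≡countLF-greedy : ∀ n → SF n ≡ countLF (greedy n n)
SF≡countLF-greedy n with b , greedy≡ ← drop0s-split (greedy n n) =
  trans (SF≡countLF-repF n) (trans (sym (countLF-0*++ b (repF n))) (cong countLF (sym greedy≡)))

SF-nthEndingIn : ∀ {q} → Admissible q → ∀ n → SF (nthEndingIn q n) ≡ countLF (greedy n n ++ q)
SF-nthEndingIn {q} adm n = begin
  SF a
    ≡⟨ SF≡countLF-greedy a ⟩
  countLF (greedy a a)
    ≡⟨ greedy-padding-invariant countLF countLF-0*++ {a} {length W} (n<F a) (valF<F W (no11-greedy-++ adm n)) ⟩
  countLF (greedy (length W) a)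
    ≡⟨ cong countLF (greedy-nthEndingIn adm n) ⟩
  countLF W ∎
  where
  W : Word
  W = greedy n n ++ q
  a : ℕ
  a = nthEndingIn q n

suffixSeq : Word → ℕ → ℤ
suffixSeq q n = + countLF (greedy n n ++ q)

SF-Iq : ∀ {q} → Admissible q → ∀ {n m} → Iq q n m → + SF m ≡ suffixSeq q n
SF-Iq adm {n} {m} iq = cong +_ (trans (cong SF (Iq⇒≡nthEndingIn adm {n} {m} iq)) (SF-nthEndingIn adm n))

suffixSeq-[] : ∀ n → suffixSeq [] n ≡ + SF n
suffixSeq-[] n = cong +_ (trans (cong countLF (++-identityʳ (greedy n n))) (sym (SF≡countLF-greedy n)))

pos-difference : ∀ a b c → c + b ≡ a → + c ≡ + a - + b
pos-difference a b c c+b≡a = sym (begin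
  + a - + b      ≡⟨ ℤP.m-n≡m⊖n a b ⟩
  a ⊖ b          ≡⟨ ℤP.⊖-≥ (subst (b ≤_) c+b≡a (m≤n+m b c)) ⟩
  + (a ∸ b)      ≡⟨ cong (λ x → + (x ∸ b)) c+b≡a ⟨
  + (c + b ∸ b)  ≡⟨ cong +_ (m+n∸n≡m c b) ⟩
  + c            ∎)

++-∷ʳ : ∀ (w p : Word) a → w ++ (p ∷ʳ a) ≡ (w ++ p) ∷ʳ a
++-∷ʳ w p a = sym (++-assoc w p (a ∷ []))

suffixSeq-∷ʳ00 : ∀ p n → suffixSeq ((p ∷ʳ false) ∷ʳ false) n ≡ + 2 * suffixSeq (p ∷ʳ false) n - suffixSeq p n
suffixSeq-∷ʳ00 p n rewrite ++-∷ʳ (greedy n n) (p ∷ʳ false) false | ++-∷ʳ (greedy n n) p false =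
  trans (pos-difference (2 ℕ.* countLF (u ∷ʳ false)) (countLF u) (countLF ((u ∷ʳ false) ∷ʳ false)) (countLF-∷ʳ00 u))
        (cong (_- + countLF u) (ℤP.pos-* 2 (countLF (u ∷ʳ false))))
  where
  u : Word
  u = greedy n n ++ p

suffixSeq-∷ʳ01 : ∀ p n → suffixSeq ((p ∷ʳ false) ∷ʳ true) n ≡ + 2 * suffixSeq p n
suffixSeq-∷ʳ01 p n rewrite ++-∷ʳ (greedy n n) (p ∷ʳ false) true | ++-∷ʳ (greedy n n) p false =
  trans (cong +_ (countLF-∷ʳ01 (greedy n n ++ p))) (ℤP.pos-* 2 (countLF (greedy n n ++ p)))

suffixSeq-∷ʳ010 : ∀ p n → suffixSeq (((p ∷ʳ false) ∷ʳ true) ∷ʳ false) n ≡ + 3 * suffixSeq p n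
suffixSeq-∷ʳ010 p n
  rewrite ++-∷ʳ (greedy n n) ((p ∷ʳ false) ∷ʳ true) false
        | ++-∷ʳ (greedy n n) (p ∷ʳ false) true
        | ++-∷ʳ (greedy n n) p false =
  trans (cong +_ (countLF-∷ʳ010 (greedy n n ++ p))) (ℤP.pos-* 3 (countLF (greedy n n ++ p)))

-- The letter before the block 1q′ exists thanks to the padding, and it cannot be 1.
inI-1∷ : ∀ q′ m → inI (true ∷ q′) m ≡ inI (false ∷ true ∷ q′) m
inI-1∷ q′ m = begin
  inI (true ∷ q′) m               ≡⟨ inI≡endsWith-greedy (true ∷ q′) m K (n≤1+n _) ⟩
  endsWith (true ∷ q′) W          ≡⟨ ⇔→≡ {z = true} (mk⇔ 1q′⇒01q′ 01q′⇒1q′) ⟩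
  endsWith (false ∷ true ∷ q′) W  ≡⟨ inI≡endsWith-greedy (false ∷ true ∷ q′) m K ≤-refl ⟨
  inI (false ∷ true ∷ q′) m       ∎
  where
  K : ℕ
  K = suc (suc (length q′))
  W : Word
  W = greedy (K + m) m
  ∷ʳ-++ : ∀ w a q → W ≡ (w ∷ʳ a) ++ q → W ≡ w ++ a ∷ q
  ∷ʳ-++ w a q W≡ = trans W≡ (++-assoc w (a ∷ []) q)
  01q′⇒1q′ : endsWith (false ∷ true ∷ q′) W ≡ true → endsWith (true ∷ q′) W ≡ true
  01q′⇒1q′ h with w , W≡ ← endsWith⇒++ (false ∷ true ∷ q′) W h =
    endsWith-≡++ (w ∷ʳ false) (true ∷ q′) (trans W≡ (sym (++-assoc w (false ∷ []) (true ∷ q′))))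
  1q′⇒01q′ : endsWith (true ∷ q′) W ≡ true → endsWith (false ∷ true ∷ q′) W ≡ true
  1q′⇒01q′ h with w , W≡ ← endsWith⇒++ (true ∷ q′) W h with initLast w
  ... | [] = contradiction (subst (K ≤_) (trans (sym (length-greedy (K + m) m)) (cong length W≡)) (m≤m+n K m)) (<-irrefl refl)
  ... | w′ ∷ʳ′ true  =
    contradiction (trans (sym (no11-11 w′ q′)) (trans (cong no11 (sym (∷ʳ-++ w′ true _ W≡))) (no11-greedy-+ K m))) λ ()
  ... | w′ ∷ʳ′ false = endsWith-≡++ w′ (false ∷ true ∷ q′) (∷ʳ-++ w′ false _ W≡)

Admissible-∷ʳ⁻ : ∀ {p a} → Admissible (p ∷ʳ a) → Admissible p
Admissible-∷ʳ⁻ {p} {a} (admissible no11-q ¬begins1) = admissible (no11-++⁻ˡ p (a ∷ []) no11-q) (begins1-∷ʳ⁻ p ¬begins1)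
  where
  begins1-∷ʳ⁻ : ∀ p → begins1 (p ∷ʳ a) ≡ false → begins1 p ≡ false
  begins1-∷ʳ⁻ []          _ = refl
  begins1-∷ʳ⁻ (false ∷ _) _ = refl

no11-∷ʳ11 : ∀ p → no11 ((p ∷ʳ true) ∷ʳ true) ≢ true
no11-∷ʳ11 p h with () ← trans (sym (no11-11 p [])) (trans (cong no11 (sym (++-assoc p (true ∷ []) (true ∷ [])))) h)

sF : ℕ → ℤ
sF n = + SF n

suffixSeq-inKernel : ∀ {q} → Admissible q → InKernel sF (suffixSeq q)
suffixSeq-inKernel {q} adm = q , (nthEndingIn q 0 , inI-nthEndingIn adm 0) , λ n m iq → sym (SF-Iq adm {n} {m} iq)

kernelSeq≡suffixSeq : ∀ {q} q′ {t : ℕ → ℤ} → Admissible q → (∀ n → Iq q′ n (nthEndingIn q n)) →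
  (∀ n m → Iq q′ n m → t n ≡ sF m) → ∀ n → t n ≡ suffixSeq q n
kernelSeq≡suffixSeq {q} q′ adm iq t≡ n = trans (t≡ n (nthEndingIn q n) (iq n)) (cong +_ (SF-nthEndingIn adm n))

inKernel⇒suffixSeq : ∀ {t} → InKernel sF t → Σ Word λ q → Admissible q × (∀ n → t n ≡ suffixSeq q n)
inKernel⇒suffixSeq ([] , _ , t≡) = [] , adm , kernelSeq≡suffixSeq [] adm (Iq-nthEndingIn adm) t≡
  where
  adm : Admissible []
  adm = admissible refl refl
inKernel⇒suffixSeq ((false ∷ q′) , (m , inI-m) , t≡) =
  false ∷ q′ , adm , kernelSeq≡suffixSeq (false ∷ q′) adm (Iq-nthEndingIn adm) t≡
  where
  adm : Admissible (false ∷ q′)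
  adm = admissible (inI⇒no11 (false ∷ q′) m inI-m) refl
inKernel⇒suffixSeq ((true ∷ q′) , (m , inI-m) , t≡) =
  false ∷ true ∷ q′ , adm , kernelSeq≡suffixSeq (true ∷ q′) adm iq t≡
  where
  adm : Admissible (false ∷ true ∷ q′)
  adm = admissible (inI⇒no11 (true ∷ q′) m inI-m) refl
  iq : ∀ n → Iq (true ∷ q′) n (nthEndingIn (false ∷ true ∷ q′) n)
  iq n = IsNth-cong (inI-1∷ q′) {n} {nthEndingIn (false ∷ true ∷ q′) n} (Iq-nthEndingIn adm n)

generators : List (ℕ → ℤ)
generators = suffixSeq [] ∷ suffixSeq (false ∷ []) ∷ []

suffixSeq-span : ∀ {q} → Reverse q → Admissible q → Span (_∈ generators) (suffixSeq q)
suffixSeq-span []                  _ = gen (here refl)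
suffixSeq-span (_ ∶ [] ∶ʳ false)   _ = gen (there (here refl))
suffixSeq-span (_ ∶ [] ∶ʳ true)    (admissible _ ())
suffixSeq-span (_ ∶ (p ∶ r ∶ʳ false) ∶ʳ false) adm =
  ext (add (scale (+ 2) (suffixSeq-span (p ∶ r ∶ʳ false) (Admissible-∷ʳ⁻ adm)))
           (scale -1ℤ (suffixSeq-span r (Admissible-∷ʳ⁻ (Admissible-∷ʳ⁻ adm)))))
      (λ n → sym (trans (suffixSeq-∷ʳ00 p n)
                        (cong (ℤ._+_ (+ 2 * suffixSeq (p ∷ʳ false) n)) (sym (ℤP.-1*i≡-i (suffixSeq p n))))))
suffixSeq-span (_ ∶ (p ∶ r ∶ʳ false) ∶ʳ true) adm =
  ext (scale (+ 2) (suffixSeq-span r (Admissible-∷ʳ⁻ (Admissible-∷ʳ⁻ adm)))) (λ n → sym (suffixSeq-∷ʳ01 p n))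
suffixSeq-span (_ ∶ (p ∶ _ ∶ʳ true) ∶ʳ true) adm = contradiction (Admissible.no11-q adm) (no11-∷ʳ11 p)
suffixSeq-span (_ ∶ (_ ∶ [] ∶ʳ true) ∶ʳ false) (admissible _ ())
suffixSeq-span (_ ∶ (_ ∶ (p ∶ _ ∶ʳ true) ∶ʳ true) ∶ʳ false) adm =
  contradiction (Admissible.no11-q (Admissible-∷ʳ⁻ adm)) (no11-∷ʳ11 p)
suffixSeq-span (_ ∶ (_ ∶ (p ∶ r ∶ʳ false) ∶ʳ true) ∶ʳ false) adm =
  ext (scale (+ 3) (suffixSeq-span r (Admissible-∷ʳ⁻ (Admissible-∷ʳ⁻ (Admissible-∷ʳ⁻ adm)))))
      (λ n → sym (suffixSeq-∷ʳ010 p n))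

spanKernel⊆spanGenerators : ∀ {t} → Span (InKernel sF) t → Span (_∈ generators) t
spanKernel⊆spanGenerators (gen t∈K) with q , adm , t≗ ← inKernel⇒suffixSeq t∈K =
  ext (suffixSeq-span (reverseView q) adm) (λ n → sym (t≗ n))
spanKernel⊆spanGenerators zero0       = zero0
spanKernel⊆spanGenerators (add f g)   = add (spanKernel⊆spanGenerators f) (spanKernel⊆spanGenerators g)
spanKernel⊆spanGenerators (scale c f) = scale c (spanKernel⊆spanGenerators f)
spanKernel⊆spanGenerators (ext f f≗g) = ext (spanKernel⊆spanGenerators f) f≗g

generators⊆spanKernel : ∀ {g} → g ∈ generators → Span (InKernel sF) g
generators⊆spanKernel (here refl)         = gen (suffixSeq-inKernel (admissible refl refl))
generators⊆spanKernel (there (here refl)) = gen (suffixSeq-inKernel (admissible refl refl))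

SF-FRegular : FRegular sF
SF-FRegular = generators , generators⊆spanKernel , spanKernel⊆spanGenerators

SF-i00 : (n a b : ℕ) → Iq (false ∷ false ∷ []) n a → Iq (false ∷ []) n b → + SF a ≡ (+ 2) * (+ SF b) - + SF n
SF-i00 n a b i₀₀ i₀ = begin
  + SF a                                          ≡⟨ SF-Iq (admissible refl refl) {n} {a} i₀₀ ⟩
  suffixSeq (false ∷ false ∷ []) n                ≡⟨ suffixSeq-∷ʳ00 [] n ⟩
  + 2 * suffixSeq (false ∷ []) n - suffixSeq [] n
    ≡⟨ cong₂ (λ x y → + 2 * x - y) (sym (SF-Iq (admissible refl refl) {n} {b} i₀)) (suffixSeq-[] n) ⟩
  + 2 * + SF b - + SF n                           ∎

SF-i01 : (n a : ℕ) → Iq (false ∷ true ∷ []) n a → + SF a ≡ (+ 2) * (+ SF n)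
SF-i01 n a i₀₁ = begin
  + SF a                          ≡⟨ SF-Iq (admissible refl refl) {n} {a} i₀₁ ⟩
  suffixSeq (false ∷ true ∷ []) n ≡⟨ suffixSeq-∷ʳ01 [] n ⟩
  + 2 * suffixSeq [] n            ≡⟨ cong (λ x → + 2 * x) (suffixSeq-[] n) ⟩
  + 2 * + SF n                    ∎

SF-i010 : (n a : ℕ) → Iq (false ∷ true ∷ false ∷ []) n a → + SF a ≡ (+ 3) * (+ SF n)
SF-i010 n a i₀₁₀ = begin
  + SF a                                 ≡⟨ SF-Iq (admissible refl refl) {n} {a} i₀₁₀ ⟩
  suffixSeq (false ∷ true ∷ false ∷ []) n ≡⟨ suffixSeq-∷ʳ010 [] n ⟩
  + 3 * suffixSeq [] n                   ≡⟨ cong (λ x → + 3 * x) (suffixSeq-[] n) ⟩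
  + 3 * + SF n                           ∎

theorem9p9 : ((n a b : ℕ) → Iq (false ∷ false ∷ []) n a → Iq (false ∷ []) n b → + SF a ≡ (+ 2) * (+ SF b) - + SF n)
    × ((n a : ℕ) → Iq (false ∷ true ∷ []) n a → + SF a ≡ (+ 2) * (+ SF n))
    × ((n a : ℕ) → Iq (false ∷ true ∷ false ∷ []) n a → + SF a ≡ (+ 3) * (+ SF n))
    × FRegular (λ n → + SF n)
theorem9p9 = SF-i00 , SF-i01 , SF-i010 , SF-FRegular
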